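{- Let $\mathcal V$ be a prelinear variety of residuated lattices and let $\mathbf A\in\mathcal V$. Then $\mathbf A$ is well-connected if and only if $\mathbf A$ is totally ordered.
   Context: Residuated lattices: algebras $\langle A,\vee,\wedge,\cdot,/,\backslash,1\rangle$ with lattice reduct, monoid reduct and $xy\le z\iff y\le x\backslash z\iff x\le z/y$. A variety is prelinear if all its members satisfy $(x/y)\vee(y/x)\ge1$. $\mathbf A$ is well-connected if $1$ is join prime: $a\vee b\ge1$ implies $a\ge1$ or $b\ge1$. -}

module Defs where

open import Level using (Level; _⊔_; suc)
open import Relation.Binary.Core using (Rel)
open import Algebra.Core using (Op₂)
open import Algebra.Structures using (IsMonoid)
open import Algebra.Lattice.Structures using (IsLattice)
open import Function.Bundles using (_⇔_)
open import Data.Sum using (_⊎_)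

record ResiduatedLattice (c ℓ : Level) : Set (suc (c ⊔ ℓ)) where
  infixr 7 _·_
  infixl 6 _/_
  infixr 6 _\\_
  infixr 5 _∨_
  infixr 5 _∧_
  infix 4 _≈_ _≤_
  field
    Carrier : Set c
    _≈_     : Rel Carrier ℓ
    _∨_     : Op₂ Carrier
    _∧_     : Op₂ Carrier
    _·_     : Op₂ Carrier
    _/_     : Op₂ Carrier
    _\\_    : Op₂ Carrier
    one     : Carrier
    isLattice : IsLattice _≈_ _∨_ _∧_
    isMonoid  : IsMonoid _≈_ _·_ one

  _≤_ : Rel Carrier ℓ
  x ≤ y = (x ∨ y) ≈ y

  field
    /-cong  : ∀ {x x′ y y′} → x ≈ x′ → y ≈ y′ → (x / y) ≈ (x′ / y′)
    \\-cong : ∀ {x x′ y y′} → x ≈ x′ → y ≈ y′ → (x \\ y) ≈ (x′ \\ y′)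
    residuation-\\ : ∀ x y z → (x · y ≤ z) ⇔ (y ≤ x \\ z)
    residuation-/  : ∀ x y z → (x · y ≤ z) ⇔ (x ≤ z / y)

module _ {c ℓ : Level} (A : ResiduatedLattice c ℓ) where
  open ResiduatedLattice A

  Prelinear : Set (c ⊔ ℓ)
  Prelinear = ∀ x y → one ≤ (x / y) ∨ (y / x)

  WellConnected : Set (c ⊔ ℓ)
  WellConnected = ∀ a b → one ≤ a ∨ b → (one ≤ a) ⊎ (one ≤ b)

  TotallyOrdered : Set (c ⊔ ℓ)
  TotallyOrdered = ∀ x y → (x ≤ y) ⊎ (y ≤ x)

PrelinearClass : ∀ {c ℓ p} → (ResiduatedLattice c ℓ → Set p) → Set (suc (c ⊔ ℓ) ⊔ p)
PrelinearClass 𝒱 = ∀ B → 𝒱 B → Prelinear B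

module Submission where

-- By residuation, 1 ≤ x/y holds exactly when y ≤ x, so prelinearity says that 1 lies
-- below the join of the two comparison elements x/y and y/x; join primality of 1 then
-- picks one of them. Conversely, in a chain a ∨ b is a or b.

open import Defs
open import Level using (Level)
open import Function.Bundles using (_⇔_; mk⇔; Equivalence)
open import Data.Sum using (inj₁; inj₂)
open import Algebra.Structures using (IsMonoid)
open import Algebra.Lattice.Structures using (IsLattice)
open import Relation.Binary.Structures using (IsEquivalence)

module _ {c ℓ : Level} (A : ResiduatedLattice c ℓ) where
  open ResiduatedLattice A
  open IsLattice isLattice using (isEquivalence; ∨-cong; ∨-comm)
  open IsEquivalence isEquivalence renaming (refl to ≈-refl; sym to ≈-sym; trans to ≈-trans)
  open IsMonoid isMonoid using (identityˡ)

  one≤x/y⇒y≤x : ∀ x y → one ≤ x / y → y ≤ x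
  one≤x/y⇒y≤x x y one≤x/y =
    ≈-trans (∨-cong (≈-sym (identityˡ y)) ≈-refl)
            (Equivalence.from (residuation-/ one y x) one≤x/y)

  ≤-∨-absorbˡ : ∀ {x a b} → a ≤ b → x ≤ a ∨ b → x ≤ b
  ≤-∨-absorbˡ {x} a≤b x≤a∨b = ≈-trans (∨-cong ≈-refl (≈-sym a≤b)) (≈-trans x≤a∨b a≤b)

  ≤-∨-absorbʳ : ∀ {x a b} → b ≤ a → x ≤ a ∨ b → x ≤ a
  ≤-∨-absorbʳ {a = a} {b} b≤a x≤a∨b =
    ≤-∨-absorbˡ b≤a
      (≈-trans (∨-cong ≈-refl (∨-comm b a)) (≈-trans x≤a∨b (∨-comm a b)))

  prelinear∧wellConnected⇒totallyOrdered :
    Prelinear A → WellConnected A → TotallyOrdered A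
  prelinear∧wellConnected⇒totallyOrdered prelinear wellConnected x y
    with wellConnected (x / y) (y / x) (prelinear x y)
  ... | inj₁ one≤x/y = inj₂ (one≤x/y⇒y≤x x y one≤x/y)
  ... | inj₂ one≤y/x = inj₁ (one≤x/y⇒y≤x y x one≤y/x)

  totallyOrdered⇒wellConnected : TotallyOrdered A → WellConnected A
  totallyOrdered⇒wellConnected totallyOrdered a b one≤a∨b with totallyOrdered a b
  ... | inj₁ a≤b = inj₂ (≤-∨-absorbˡ a≤b one≤a∨b)
  ... | inj₂ b≤a = inj₁ (≤-∨-absorbʳ b≤a one≤a∨b)

mainTheorem15 : ∀ {c ℓ p : Level} (𝒱 : ResiduatedLattice c ℓ → Set p) →
    PrelinearClass 𝒱 → (A : ResiduatedLattice c ℓ) → 𝒱 A →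
    WellConnected A ⇔ TotallyOrdered A
mainTheorem15 𝒱 prelinearClass A A∈𝒱 =
  mk⇔ (prelinear∧wellConnected⇒totallyOrdered A (prelinearClass A A∈𝒱))
      (totallyOrdered⇒wellConnected A)
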